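{- Let $G = Z_{20}\times Z_{110}$ with multiplication $[x,y][u,v] = [x+u \bmod 20,\; y\cdot 3^{u} + v \bmod 110]$ (a group of order $2200$). Let $S=\{g,g^{ -1} : g\in\{[17,1],[3,0],[2,80],[4,33],[8,6]\}\}$. Then $S$ consists of exactly $10$ non-identity elements and the Cayley graph $\mathrm{Cay}(G,S)$ is a connected $10$-regular graph of diameter $4$ on $2200$ vertices.
   Context: For a finite group $G$ and an inverse-closed subset $S\subseteq G$ not containing the identity, the Cayley graph $\mathrm{Cay}(G,S)$ is the undirected graph with vertex set $G$ in which $x$ and $y$ are adjacent iff $y=xs$ for some $s\in S$; it is $|S|$-regular. The diameter of a connected graph is the maximum over all pairs of vertices of the length of a shortest path between them. For integers $m,n$ and a unit $a$ of $Z_n$ whose multiplicative order divides $m$, the group $m\times_a n$ is the set $Z_m\times Z_n$ with multiplication $[x,y][u,v]=[x+u \bmod m,\; y a^u+v \bmod n]$. -}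

module Defs where

open import Data.Nat using (ℕ; zero; suc; _+_; _*_; _∸_; _^_)
open import Data.Nat.DivMod using (_mod_)
open import Data.Fin using (Fin; toℕ)
import Data.Fin.Properties as FinP
open import Data.Product using (_×_; _,_; Σ; ∃; proj₁; proj₂)
open import Data.Product.Properties using (≡-dec)
open import Data.List using (List; []; _∷_; concatMap; cartesianProduct; filter; length)
open import Data.List.Relation.Unary.Any using (Any; any?)
open import Relation.Binary.PropositionalEquality using (_≡_)
open import Relation.Binary.Definitions using (DecidableEquality)
open import Relation.Nullary using (Dec; ¬_)
open import Data.Sum using (_⊎_)
open import Data.List using (allFin)

G : Set
G = Fin 20 × Fin 110

_≟G_ : DecidableEquality G
_≟G_ = ≡-dec FinP._≟_ FinP._≟_

_·_ : G → G → G
(x , y) · (u , v) = ((toℕ x + toℕ u) mod 20) , ((toℕ y * 3 ^ toℕ u + toℕ v) mod 110)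

e : G
e = (0 mod 20) , (0 mod 110)

inv : G → G
inv (x , y) = x' , (((110 ∸ toℕ y) * 3 ^ toℕ x') mod 110)
  where
  x' : Fin 20
  x' = (20 ∸ toℕ x) mod 20

mk : ℕ → ℕ → G
mk a b = (a mod 20) , (b mod 110)

generators : List G
generators = mk 17 1 ∷ mk 3 0 ∷ mk 2 80 ∷ mk 4 33 ∷ mk 8 6 ∷ []

-- S = { g, g⁻¹ : g ∈ generators }, as a list (possibly with repetitions a priori)
S : List G
S = concatMap (λ g → g ∷ inv g ∷ []) generators

vertices : List G
vertices = cartesianProduct (allFin 20) (allFin 110)

Adj : G → G → Set
Adj x y = Any (λ s → y ≡ x · s) S

Adj? : (x y : G) → Dec (Adj x y)
Adj? x y = any? (λ s → y ≟G (x · s)) S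

degree : G → ℕ
degree x = length (filter (Adj? x) vertices)

data Walk : ℕ → G → G → Set where
  here : ∀ {x} → Walk zero x x
  step : ∀ {n x y z} → Adj x y → Walk n y z → Walk (suc n) x z

DistLe : ℕ → G → G → Set
DistLe n x y = Σ ℕ (λ k → Σ (k Data.Nat.≤ n) (λ _ → Walk k x y))

{-# OPTIONS --safe #-}
-- G is a group because 3²⁰ ≡ 1 (mod 110): whenever aᵐ ≡ 1 (mod n), the multiplication of
-- m ×_a n is associative, with identity [0,0] and inverse [x,y]⁻¹ = [−x, −y·a^(−x)], since
-- exponents of a may then be reduced mod m. The Cayley graph has degree |S| = 10 because S
-- has no repetitions and left multiplication is injective. Left translations are graph
-- automorphisms, so all distances are distances from e. A breadth-first search supplies for
-- every element a word of length at most 4 over S, checked by evaluating it; conversely, an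
-- exhaustive search over the 1111 walks of length at most 3 from e shows that none ends at
-- [8,50].
module Submission where

open import Defs
open import Algebra.Bundles using (Group)
open import Algebra.Structures using (IsGroup)
import Algebra.Properties.Group as GroupProperties
open import Data.Bool using (if_then_else_)
open import Data.Fin using (Fin; toℕ)
open import Data.Fin.Properties using (toℕ-injective; toℕ-fromℕ<; toℕ<n)
open import Data.List using (List; []; _∷_; length; map; filter; lookup; head; mapMaybe; allFin)
open import Data.List.Properties using (length-map)
open import Data.List.Membership.Propositional using (_∈_; find)
open import Data.List.Membership.Propositional.Properties using (∈-lookup; ∈-allFin; ∈-cartesianProduct⁺; ∈-filter⁺; ∈-filter⁻)
open import Data.List.Membership.Propositional.Properties.WithK using (unique∧set⇒bag)
open import Data.List.Relation.Binary.BagAndSetEquality using (_∼[_]_; set; ∼bag⇒↭)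
open import Data.List.Relation.Binary.Permutation.Propositional using (_↭_)
open import Data.List.Relation.Binary.Permutation.Propositional.Properties using (↭-length)
open import Data.List.Relation.Unary.All using (All; all?)
import Data.List.Relation.Unary.All as All
open import Data.List.Relation.Unary.Any using (Any; any?)
import Data.List.Relation.Unary.Any as Any
import Data.List.Relation.Unary.Any.Properties as Any
open import Data.List.Relation.Unary.Unique.Propositional using (Unique)
import Data.List.Relation.Unary.Unique.Propositional.Properties as Unique
open import Data.List.Relation.Unary.Unique.DecPropositional _≟G_ using (unique?)
open import Data.Maybe using (Maybe; just; nothing; _<∣>_)
import Data.Maybe as Maybe
import Data.Maybe.Relation.Unary.Any as MaybeAny
open import Data.Nat using (ℕ; zero; suc; _+_; _*_; _∸_; _^_; _≤_; _≤?_; s≤s; NonZero; _%_; _/_)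
open import Data.Nat.DivMod using (_mod_; %-distribˡ-+; %-distribˡ-*; m%n%n≡m%n; m<n⇒m%n≡m; m%n<n; m≡m%n+[m/n]*n; [m+kn]%n≡m%n; [m+n]%n≡m%n)
open import Data.Nat.Properties using (+-assoc; *-comm; +-identityʳ; *-identityʳ; *-distribʳ-+; ^-distribˡ-+-*; ^-*-assoc; ^-zeroˡ; m+[n∸m]≡n; <⇒≤; anyUpTo?)
open import Data.Nat.Solver using (module +-*-Solver)
open import Data.Product using (Σ; _×_; _,_; proj₂; map₂)
open import Data.Vec using (Vec; tabulate)
import Data.Vec as Vec
open import Function.Bundles using (mk⇔)
open import Level using (0ℓ)
open import Relation.Binary.PropositionalEquality using (_≡_; _≢_; refl; sym; trans; cong; cong₂; subst; isEquivalence; module ≡-Reasoning)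
open import Relation.Nullary using (Dec; does; ¬_; ¬?; _×-dec_)
open import Relation.Nullary.Decidable using (map′; from-yes; from-no)

module Congruence (n : ℕ) .{{_ : NonZero n}} where

  infix 4 _≋_
  _≋_ : ℕ → ℕ → Set
  j ≋ k = j % n ≡ k % n

  %-≋ : ∀ j → j % n ≋ j
  %-≋ j = m%n%n≡m%n j n

  +-cong : ∀ {i j k l} → i ≋ j → k ≋ l → i + k ≋ j + l
  +-cong {i} {j} {k} {l} i≋j k≋l = begin
    (i + k) % n              ≡⟨ %-distribˡ-+ i k n ⟩
    (i % n + k % n) % n      ≡⟨ cong₂ (λ p q → (p + q) % n) i≋j k≋l ⟩
    (j % n + l % n) % n      ≡⟨ %-distribˡ-+ j l n ⟨
    (j + l) % n              ∎
    where open ≡-Reasoning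

  *-cong : ∀ {i j k l} → i ≋ j → k ≋ l → i * k ≋ j * l
  *-cong {i} {j} {k} {l} i≋j k≋l = begin
    (i * k) % n              ≡⟨ %-distribˡ-* i k n ⟩
    (i % n * (k % n)) % n    ≡⟨ cong₂ (λ p q → (p * q) % n) i≋j k≋l ⟩
    (j % n * (l % n)) % n    ≡⟨ %-distribˡ-* j l n ⟨
    (j * l) % n              ∎
    where open ≡-Reasoning

  +-congˡ : ∀ i {k l} → k ≋ l → i + k ≋ i + l
  +-congˡ i = +-cong {i} {i} refl

  +-congʳ : ∀ k {i j} → i ≋ j → i + k ≋ j + k
  +-congʳ k i≋j = +-cong {k = k} {k} i≋j refl

  *-congˡ : ∀ i {k l} → k ≋ l → i * k ≋ i * l
  *-congˡ i = *-cong {i} {i} refl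

  *-congʳ : ∀ k {i j} → i ≋ j → i * k ≋ j * k
  *-congʳ k i≋j = *-cong {k = k} {k} i≋j refl

  ^-congˡ : ∀ {j k} → j ≋ k → ∀ i → j ^ i ≋ k ^ i
  ^-congˡ j≋k zero    = refl
  ^-congˡ j≋k (suc i) = *-cong j≋k (^-congˡ j≋k i)

  n≋0 : n ≋ 0
  n≋0 = [m+n]%n≡m%n 0 n

  multiple≋0 : ∀ k → k * n ≋ 0
  multiple≋0 k = [m+kn]%n≡m%n 0 k n

  toℕ-mod : ∀ k → toℕ (k mod n) ≡ k % n
  toℕ-mod k = toℕ-fromℕ< (m%n<n k n)

  toℕ-mod-≋ : ∀ k → toℕ (k mod n) ≋ k
  toℕ-mod-≋ k = trans (cong (_% n) (toℕ-mod k)) (%-≋ k)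

  mod-cong : ∀ {j k} → j ≋ k → j mod n ≡ k mod n
  mod-cong {j} {k} j≋k = toℕ-injective (trans (toℕ-mod j) (trans j≋k (sym (toℕ-mod k))))

  mod-≋-toℕ : ∀ {j} (i : Fin n) → j ≋ toℕ i → j mod n ≡ i
  mod-≋-toℕ {j} i j≋i = toℕ-injective (trans (toℕ-mod j) (trans j≋i (m<n⇒m%n≡m (toℕ<n i))))

module SemidirectProduct (m n a : ℕ) .{{_ : NonZero m}} .{{_ : NonZero n}}
                         (aᵐ≋1 : a ^ m % n ≡ 1 % n) where

  module Mₘ = Congruence m
  module Mₙ = Congruence n
  open Mₙ using (_≋_)

  Carrier : Set
  Carrier = Fin m × Fin n

  infixl 7 _∙_
  infix 8 _⁻¹

  _∙_ : Carrier → Carrier → Carrier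
  (x , y) ∙ (u , v) = (toℕ x + toℕ u) mod m , (toℕ y * a ^ toℕ u + toℕ v) mod n

  ε : Carrier
  ε = 0 mod m , 0 mod n

  _⁻¹ : Carrier → Carrier
  (x , y) ⁻¹ = -x , ((n ∸ toℕ y) * a ^ toℕ -x) mod n
    where
    -x : Fin m
    -x = (m ∸ toℕ x) mod m

  a^[k%m]≋a^k : ∀ k → a ^ (k % m) ≋ a ^ k
  a^[k%m]≋a^k k = begin
    a ^ (k % m) % n                          ≡⟨ cong (_% n) (*-identityʳ (a ^ (k % m))) ⟨
    a ^ (k % m) * 1 % n                      ≡⟨ cong (λ i → a ^ (k % m) * i % n) (^-zeroˡ (k / m)) ⟨
    a ^ (k % m) * 1 ^ (k / m) % n            ≡⟨ Mₙ.*-congˡ (a ^ (k % m)) (Mₙ.^-congˡ aᵐ≋1 (k / m)) ⟨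
    a ^ (k % m) * (a ^ m) ^ (k / m) % n      ≡⟨ cong (λ i → a ^ (k % m) * i % n) (^-*-assoc a m (k / m)) ⟩
    a ^ (k % m) * a ^ (m * (k / m)) % n      ≡⟨ cong (λ i → a ^ (k % m) * a ^ i % n) (*-comm m (k / m)) ⟩
    a ^ (k % m) * a ^ (k / m * m) % n        ≡⟨ cong (_% n) (^-distribˡ-+-* a (k % m) (k / m * m)) ⟨
    a ^ (k % m + k / m * m) % n              ≡⟨ cong (λ i → a ^ i % n) (m≡m%n+[m/n]*n k m) ⟨
    a ^ k % n                                ∎
    where open ≡-Reasoning

  a^toℕ-mod-≋ : ∀ k → a ^ toℕ (k mod m) ≋ a ^ k
  a^toℕ-mod-≋ k = trans (cong (λ i → a ^ i % n) (Mₘ.toℕ-mod k)) (a^[k%m]≋a^k k)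

  ∙-assoc : ∀ p q r → (p ∙ q) ∙ r ≡ p ∙ (q ∙ r)
  ∙-assoc (x , y) (u , v) (w , t) = cong₂ _,_ (Mₘ.mod-cong first) (Mₙ.mod-cong second)
    where
    open ≡-Reasoning
    open +-*-Solver using (solve; _:+_; _:*_; _:=_)
    X = toℕ x ; Y = toℕ y ; U = toℕ u ; V = toℕ v ; W = toℕ w ; T = toℕ t

    first : (toℕ ((X + U) mod m) + W) % m ≡ (X + toℕ ((U + W) mod m)) % m
    first = begin
      (toℕ ((X + U) mod m) + W) % m  ≡⟨ Mₘ.+-congʳ W (Mₘ.toℕ-mod-≋ (X + U)) ⟩
      (X + U + W) % m                ≡⟨ cong (_% m) (+-assoc X U W) ⟩
      (X + (U + W)) % m              ≡⟨ Mₘ.+-congˡ X (Mₘ.toℕ-mod-≋ (U + W)) ⟨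
      (X + toℕ ((U + W) mod m)) % m  ∎

    second : (toℕ ((Y * a ^ U + V) mod n) * a ^ W + T) % n
           ≡ (Y * a ^ toℕ ((U + W) mod m) + toℕ ((V * a ^ W + T) mod n)) % n
    second = begin
      (toℕ ((Y * a ^ U + V) mod n) * a ^ W + T) % n
        ≡⟨ Mₙ.+-congʳ T (Mₙ.*-congʳ (a ^ W) (Mₙ.toℕ-mod-≋ (Y * a ^ U + V))) ⟩
      ((Y * a ^ U + V) * a ^ W + T) % n
        ≡⟨ cong (_% n) (solve 5 (λ y p q v t → (y :* p :+ v) :* q :+ t := y :* (p :* q) :+ (v :* q :+ t))
                               refl Y (a ^ U) (a ^ W) V T) ⟩
      (Y * (a ^ U * a ^ W) + (V * a ^ W + T)) % n
        ≡⟨ cong (λ i → (Y * i + (V * a ^ W + T)) % n) (^-distribˡ-+-* a U W) ⟨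
      (Y * a ^ (U + W) + (V * a ^ W + T)) % n
        ≡⟨ Mₙ.+-cong (Mₙ.*-congˡ Y (a^toℕ-mod-≋ (U + W))) (Mₙ.toℕ-mod-≋ (V * a ^ W + T)) ⟨
      (Y * a ^ toℕ ((U + W) mod m) + toℕ ((V * a ^ W + T) mod n)) % n
        ∎

  ∙-identityˡ : ∀ p → ε ∙ p ≡ p
  ∙-identityˡ (u , v) =
    cong₂ _,_ (Mₘ.mod-≋-toℕ u (Mₘ.+-congʳ (toℕ u) (Mₘ.toℕ-mod-≋ 0)))
              (Mₙ.mod-≋-toℕ v (Mₙ.+-congʳ (toℕ v) (Mₙ.*-congʳ (a ^ toℕ u) (Mₙ.toℕ-mod-≋ 0))))

  ∙-identityʳ : ∀ p → p ∙ ε ≡ p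
  ∙-identityʳ (x , y) = cong₂ _,_ (Mₘ.mod-≋-toℕ x first) (Mₙ.mod-≋-toℕ y second)
    where
    open ≡-Reasoning
    X = toℕ x ; Y = toℕ y

    first : (X + toℕ (0 mod m)) % m ≡ X % m
    first = trans (Mₘ.+-congˡ X (Mₘ.toℕ-mod-≋ 0)) (cong (_% m) (+-identityʳ X))

    second : (Y * a ^ toℕ (0 mod m) + toℕ (0 mod n)) % n ≡ Y % n
    second = begin
      (Y * a ^ toℕ (0 mod m) + toℕ (0 mod n)) % n
        ≡⟨ Mₙ.+-cong (Mₙ.*-congˡ Y (a^toℕ-mod-≋ 0)) (Mₙ.toℕ-mod-≋ 0) ⟩
      (Y * 1 + 0) % n
        ≡⟨ cong (_% n) (trans (+-identityʳ (Y * 1)) (*-identityʳ Y)) ⟩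
      Y % n
        ∎

  ∙-inverseʳ : ∀ p → p ∙ p ⁻¹ ≡ ε
  ∙-inverseʳ (x , y) = cong₂ _,_ (Mₘ.mod-cong first) (Mₙ.mod-cong second)
    where
    open ≡-Reasoning
    X = toℕ x ; Y = toℕ y
    A = a ^ toℕ ((m ∸ X) mod m)

    first : (X + toℕ ((m ∸ X) mod m)) % m ≡ 0 % m
    first = begin
      (X + toℕ ((m ∸ X) mod m)) % m  ≡⟨ Mₘ.+-congˡ X (Mₘ.toℕ-mod-≋ (m ∸ X)) ⟩
      (X + (m ∸ X)) % m              ≡⟨ cong (_% m) (m+[n∸m]≡n (<⇒≤ (toℕ<n x))) ⟩
      m % m                          ≡⟨ Mₘ.n≋0 ⟩
      0 % m                          ∎

    second : (Y * A + toℕ (((n ∸ Y) * A) mod n)) % n ≡ 0 % n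
    second = begin
      (Y * A + toℕ (((n ∸ Y) * A) mod n)) % n  ≡⟨ Mₙ.+-congˡ (Y * A) (Mₙ.toℕ-mod-≋ ((n ∸ Y) * A)) ⟩
      (Y * A + (n ∸ Y) * A) % n                ≡⟨ cong (_% n) (*-distribʳ-+ A Y (n ∸ Y)) ⟨
      ((Y + (n ∸ Y)) * A) % n                  ≡⟨ cong (λ k → k * A % n) (m+[n∸m]≡n (<⇒≤ (toℕ<n y))) ⟩
      (n * A) % n                              ≡⟨ cong (_% n) (*-comm n A) ⟩
      (A * n) % n                              ≡⟨ Mₙ.multiple≋0 A ⟩
      0 % n                                    ∎

  -- The left inverse law needs no computation: as in any monoid with right inverses, it
  -- follows from the right one.
  ⁻¹-involutive : ∀ p → p ⁻¹ ⁻¹ ≡ p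
  ⁻¹-involutive p = begin
    p ⁻¹ ⁻¹                  ≡⟨ ∙-identityˡ (p ⁻¹ ⁻¹) ⟨
    ε ∙ p ⁻¹ ⁻¹              ≡⟨ cong (_∙ p ⁻¹ ⁻¹) (∙-inverseʳ p) ⟨
    p ∙ p ⁻¹ ∙ p ⁻¹ ⁻¹       ≡⟨ ∙-assoc p (p ⁻¹) (p ⁻¹ ⁻¹) ⟩
    p ∙ (p ⁻¹ ∙ p ⁻¹ ⁻¹)     ≡⟨ cong (p ∙_) (∙-inverseʳ (p ⁻¹)) ⟩
    p ∙ ε                    ≡⟨ ∙-identityʳ p ⟩
    p                        ∎
    where open ≡-Reasoning

  ∙-inverseˡ : ∀ p → p ⁻¹ ∙ p ≡ ε
  ∙-inverseˡ p = trans (cong (p ⁻¹ ∙_) (sym (⁻¹-involutive p))) (∙-inverseʳ (p ⁻¹))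

  isGroup : IsGroup _≡_ _∙_ ε _⁻¹
  isGroup = record
    { isMonoid = record
      { isSemigroup = record
        { isMagma = record { isEquivalence = isEquivalence ; ∙-cong = cong₂ _∙_ }
        ; assoc   = ∙-assoc
        }
      ; identity = ∙-identityˡ , ∙-identityʳ
      }
    ; inverse = ∙-inverseˡ , ∙-inverseʳ
    ; ⁻¹-cong = cong _⁻¹
    }

  group : Group 0ℓ 0ℓ
  group = record { isGroup = isGroup }

module 𝔾 = SemidirectProduct 20 110 3 refl
open GroupProperties 𝔾.group using (∙-cancelˡ; \\-leftDividesˡ)

∈-vertices : ∀ z → z ∈ vertices
∈-vertices (x , y) = ∈-cartesianProduct⁺ (∈-allFin x) (∈-allFin y)

vertices-unique : Unique vertices
vertices-unique = Unique.cartesianProduct⁺ (Unique.allFin⁺ 20) (Unique.allFin⁺ 110)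

S-unique : Unique S
S-unique = from-yes (unique? S)

S-nonidentity : All (_≢ e) S
S-nonidentity = from-yes (all? (λ s → ¬? (s ≟G e)) S)

adj-· : ∀ x {s} → s ∈ S → Adj x (x · s)
adj-· x = Any.map (cong (x ·_))

degree≡|S| : ∀ x → degree x ≡ length S
degree≡|S| x = begin
  length neighbours   ≡⟨ ↭-length neighbours↭translates ⟩
  length translates   ≡⟨ length-map (x ·_) S ⟩
  length S            ∎
  where
  -- The lists are passed explicitly wherever they would otherwise be inferred: unification
  -- would unfold filter (Adj? x) vertices, a huge term stuck on x.
  open ≡-Reasoning
  neighbours translates : List G
  neighbours = filter (Adj? x) vertices
  translates = map (x ·_) S

  neighbours-unique : Unique neighbours
  neighbours-unique = Unique.filter⁺ (Adj? x) {xs = vertices} vertices-unique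

  translates-unique : Unique translates
  translates-unique = Unique.map⁺ {f = x ·_} (λ {s} {t} → ∙-cancelˡ x s t) {S} S-unique

  neighbour⇒translate : ∀ {z} → z ∈ neighbours → z ∈ translates
  neighbour⇒translate z∈N = Any.map⁺ {f = x ·_} (proj₂ (∈-filter⁻ (Adj? x) {xs = vertices} z∈N))

  translate⇒neighbour : ∀ {z} → z ∈ translates → z ∈ neighbours
  translate⇒neighbour {z} z∈T =
    ∈-filter⁺ (Adj? x) {xs = vertices} (∈-vertices z) (Any.map⁻ {f = x ·_} {xs = S} z∈T)

  neighbours≈translates : neighbours ∼[ set ] translates
  neighbours≈translates = mk⇔ neighbour⇒translate translate⇒neighbour

  neighbours↭translates : neighbours ↭ translates
  neighbours↭translates = ∼bag⇒↭ (unique∧set⇒bag {xs = neighbours} {ys = translates}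
                                    neighbours-unique translates-unique neighbours≈translates)

walk? : ∀ k x z → Dec (Walk k x z)
walk? zero    x z = map′ (λ { refl → here }) (λ { here → refl }) (x ≟G z)
walk? (suc k) x z = map′ fromAny toAny (any? (λ s → walk? k (x · s) z) S)
  where
  fromAny : Any (λ s → Walk k (x · s) z) S → Walk (suc k) x z
  fromAny p with (s , s∈S , w) ← find p = step (adj-· x s∈S) w
  toAny : Walk (suc k) x z → Any (λ s → Walk k (x · s) z) S
  toAny (step adj w) = Any.map (λ y≡xs → subst (λ y → Walk k y z) y≡xs w) adj

distLe? : ∀ k x z → Dec (DistLe k x z)
distLe? k x z = map′ (λ { (j , s≤s j≤k , w) → j , j≤k , w })
                     (λ { (j , j≤k , w) → j , s≤s j≤k , w })
                     (anyUpTo? (λ j → walk? j x z) (suc k))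

Word : Set
Word = List (Fin (length S))

infixl 5 _⋆_

_⋆_ : G → Word → G
x ⋆ []      = x
x ⋆ (i ∷ w) = x · lookup S i ⋆ w

walk-⋆ : ∀ x w → Walk (length w) x (x ⋆ w)
walk-⋆ x []      = here
walk-⋆ x (i ∷ w) = step (adj-· x (∈-lookup i)) (walk-⋆ (x · lookup S i) w)

⋆-translate : ∀ x y w → x · y ⋆ w ≡ x · (y ⋆ w)
⋆-translate x y []      = refl
⋆-translate x y (i ∷ w) =
  trans (cong (_⋆ w) (𝔾.∙-assoc x y (lookup S i))) (⋆-translate x (y · lookup S i) w)

ShortWord : ℕ → G → Set
ShortWord k z = Σ Word (λ w → length w ≤ k × e ⋆ w ≡ z)

distLe-translate : ∀ {k z} x → ShortWord k z → DistLe k x (x · z)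
distLe-translate x (w , |w|≤k , refl) =
  length w , |w|≤k , subst (Walk (length w) x) x⋆w≡x·[e⋆w] (walk-⋆ x w)
  where
  x⋆w≡x·[e⋆w] : x ⋆ w ≡ x · (e ⋆ w)
  x⋆w≡x·[e⋆w] = trans (cong (_⋆ w) (sym (𝔾.∙-identityʳ x))) (⋆-translate x e w)

WordTable : Set
WordTable = Vec (Vec (Maybe Word) 110) 20

_[_] : WordTable → G → Maybe Word
t [ x , y ] = Vec.lookup (Vec.lookup t x) y

tabulateG : (G → Maybe Word) → WordTable
tabulateG f = tabulate λ x → tabulate λ y → f (x , y)

-- Breadth-first search from e. Nothing is proved about it: its output is only a certificate,
-- verified by certifies?.
bfsStep : WordTable → WordTable
bfsStep t = tabulateG λ z →
  t [ z ] <∣> head (mapMaybe (λ i → Maybe.map (i ∷_) (t [ inv (lookup S i) · z ])) (allFin (length S)))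

bfs : ℕ → WordTable
bfs zero    = tabulateG λ z → if does (z ≟G e) then just [] else nothing
bfs (suc k) = bfsStep (bfs k)

Certifies : ℕ → G → Maybe Word → Set
Certifies k z = MaybeAny.Any (λ w → length w ≤ k × e ⋆ w ≡ z)

-- The table is an argument, not a global, so that it is evaluated only once
-- when bfs-certifies is checked.
certifies? : ∀ k t → Dec (All (λ z → Certifies k z (t [ z ])) vertices)
certifies? k t = all? (λ z → MaybeAny.dec (λ w → (length w ≤? k) ×-dec ((e ⋆ w) ≟G z)) (t [ z ])) vertices

bfs-certifies : All (λ z → Certifies 4 z (bfs 4 [ z ])) vertices
bfs-certifies = from-yes (certifies? 4 (bfs 4))

short-word : ∀ z → ShortWord 4 z
short-word z = MaybeAny.satisfied (All.lookup bfs-certifies (∈-vertices z))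

diameter≤4 : ∀ x y → DistLe 4 x y
diameter≤4 x y = subst (DistLe 4 x) (\\-leftDividesˡ x y) (distLe-translate x (short-word (inv x · y)))

connected : ∀ x y → Σ ℕ (λ n → Walk n x y)
connected x y = map₂ proj₂ (diameter≤4 x y)

-- Any element that bfs 3 leaves unreached would do.
far : G
far = mk 8 50

far-distance>3 : ¬ DistLe 3 e far
far-distance>3 = from-no (distLe? 3 e far)

mainTheorem10 : (Unique S × length S ≡ 10 × All (λ s → s ≢ e) S)
    × (length vertices ≡ 2200)
    × (∀ x → degree x ≡ 10)
    × (∀ x y → Σ ℕ (λ n → Walk n x y))
    × ((∀ x y → DistLe 4 x y) × Σ G (λ x → Σ G (λ y → ¬ DistLe 3 x y)))
mainTheorem10 =
  (S-unique , refl , S-nonidentity) , refl , degree≡|S| , connected , diameter≤4 , e , far , far-distance>3
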